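{- Let $L$ be a complete lattice. For all $f_0,f_1,\dots,g_0,g_1,\dots\in\mathrm{FinAdd}_L$, $$\prod_{n\ge0}(f_n\vee g_n)=\bigvee_{h_n\in\{f_n,g_n\}}\prod_{n\ge0}h_n,$$ the supremum ranging over all sequences $(h_n)_{n\ge0}$ with $h_n\in\{f_n,g_n\}$ for each $n$.
   Context: Functions are written on the right and composed left to right: $xf$ is $f$ applied to $x$, $fg$ means "first $f$, then $g$". For a complete lattice $L$, $f:L\to L$ is finitely additive if $\bot f=\bot$ and $(x\vee y)f=xf\vee yf$; $\mathrm{FinAdd}_L$ is the set of such maps, with pointwise order and pointwise binary supremum $\vee$. $\mathbf 2=\{\bot,\top\}$, $\bot<\top$. For $f_0,f_1,\dots\in\mathrm{FinAdd}_L$, the infinite product $\prod_{n\ge0}f_n:L\to\mathbf 2$ sends $x$ to $\bot$ if $xf_0f_1\cdots f_n=\bot$ for some $n\ge0$, and to $\top$ otherwise. Suprema of maps $L\to\mathbf 2$ are pointwise. -}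

module Defs where

open import Level using (Level; _⊔_) renaming (suc to lsuc)
open import Data.Nat using (ℕ; zero; suc)
open import Data.Bool using (Bool; true; false; if_then_else_)
open import Data.Product using (Σ; ∃; _×_; _,_)
open import Relation.Nullary using (¬_)
open import Relation.Binary.Lattice.Bundles using (BoundedLattice)

record CompleteLattice (c ℓ₁ ℓ₂ : Level) : Set (lsuc (c ⊔ ℓ₁ ⊔ ℓ₂)) where
  field
    boundedLattice : BoundedLattice c ℓ₁ ℓ₂
  open BoundedLattice boundedLattice public
  field
    ⋁       : {I : Set c} → (I → Carrier) → Carrier
    ⋁-upper : {I : Set c} (F : I → Carrier) (i : I) → F i ≤ ⋁ F
    ⋁-least : {I : Set c} (F : I → Carrier) (z : Carrier) →
              ((i : I) → F i ≤ z) → ⋁ F ≤ z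

module _ {c ℓ₁ ℓ₂ : Level} (L : CompleteLattice c ℓ₁ ℓ₂) where
  open CompleteLattice L

  -- f : L → L is finitely additive (and, being a function on the setoid L,
  -- respects _≈_).  Written x f in the paper = f x here.
  record IsFinAdd (f : Carrier → Carrier) : Set (c ⊔ ℓ₁) where
    field
      cong   : ∀ {x y} → x ≈ y → f x ≈ f y
      pres-⊥ : f ⊥ ≈ ⊥
      pres-∨ : ∀ x y → f (x ∨ y) ≈ (f x ∨ f y)

  record FinAdd : Set (c ⊔ ℓ₁) where
    field
      fun      : Carrier → Carrier
      isFinAdd : IsFinAdd fun
  open FinAdd public

  _∨ₚ_ : (Carrier → Carrier) → (Carrier → Carrier) → (Carrier → Carrier)
  (f ∨ₚ g) x = f x ∨ g x

  -- compose x f₀ f₁ ⋯ fₙ  (functions written on the right, applied left to right)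
  compose : (ℕ → Carrier → Carrier) → ℕ → Carrier → Carrier
  compose fs zero    x = fs zero x
  compose fs (suc n) x = fs (suc n) (compose fs n x)

  -- A map L → 𝟐 is represented by the predicate "its value at x is ⊤".
  Map𝟐 : Set (lsuc ℓ₁ ⊔ c)
  Map𝟐 = Carrier → Set ℓ₁

  -- ∏ₙ fₙ : x ↦ ⊥ if x f₀⋯fₙ = ⊥ for some n, ⊤ otherwise.
  ∏ : (ℕ → Carrier → Carrier) → Map𝟐
  ∏ fs x = ¬ (∃ λ n → compose fs n x ≈ ⊥)

  ⋁𝟐 : {I : Set} → (I → Map𝟐) → Map𝟐
  ⋁𝟐 {I} F x = Σ I λ i → F i x

  choose : (ℕ → Bool) → (ℕ → FinAdd) → (ℕ → FinAdd) → ℕ → Carrier → Carrier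
  choose ch f g n = if ch n then fun (f n) else fun (g n)

  _≐_ : Map𝟐 → Map𝟐 → Set (c ⊔ ℓ₁)
  F ≐ G = ∀ x → (F x → G x) × (G x → F x)

module Submission where

-- Write Fₙ = fₙ ∨ gₙ.  Since each hₙ ∈ {fₙ, gₙ} lies below Fₙ
-- and the Fₙ are monotone, x h₀⋯hₙ ≤ x F₀⋯Fₙ; hence ∏ₙ Fₙ kills x whenever
-- some ∏ₙ hₙ does not, which is the inequality "⋁ ≤ ∏".
-- Conversely, suppose ∏ₙ Fₙ survives at x.  Because finitely additive maps
-- (and their composites) are subadditive and a composite that reaches ⊥
-- stays at ⊥, the tail product ∏ₙ Fₙ₊₁ cannot kill both x f₀ and x g₀: it
-- would then kill x f₀ ∨ x g₀ = x F₀.  So (using excluded middle to decide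
-- which one survives) we may choose h₀ ∈ {f₀, g₀} with ∏ₙ Fₙ₊₁ surviving at
-- x h₀, and repeat on the shifted sequences.  This greedy choice sequence
-- yields an ∏ₙ hₙ that never reaches ⊥ at x.

open import Defs
open import Level using (_⊔_; Lift; lift; lower)
open import Axiom.ExcludedMiddle using (ExcludedMiddle)
open import Algebra.Bundles using (CommutativeSemigroup)
open import Algebra.Structures using (IsCommutativeBand)
open import Data.Nat using (ℕ; zero; suc; _≤′_; ≤′-refl; ≤′-step) renaming (_⊔_ to _⊔ℕ_)
open import Data.Nat.Properties using (≤⇒≤′; m≤m⊔n; m≤n⊔m)
open import Data.Bool using (Bool; true; false; if_then_else_)
open import Data.Product using (∃; _,_)
open import Relation.Nullary using (¬_; Dec; yes; no)
open import Relation.Nullary.Decidable using (map′; isYes)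
open import Relation.Binary.PropositionalEquality as P using (_≡_)

module FinAddSequences {c ℓ₁ ℓ₂} (L : CompleteLattice c ℓ₁ ℓ₂) where
  open CompleteLattice L
  open import Relation.Binary.Lattice.Properties.JoinSemilattice joinSemilattice
    using (∨-cong; isAlgSemilattice)

  ∨-commutativeSemigroup : CommutativeSemigroup c ℓ₁
  ∨-commutativeSemigroup = record
    { isCommutativeSemigroup = IsCommutativeBand.isCommutativeSemigroup isAlgSemilattice }

  open import Algebra.Properties.CommutativeSemigroup ∨-commutativeSemigroup
    using (interchange)

  ≤⊥⇒≈⊥ : ∀ {a} → a ≤ ⊥ → a ≈ ⊥
  ≤⊥⇒≈⊥ {a} a≤⊥ = antisym a≤⊥ (minimum a)

  -- A finitely additive map is monotone: a ≤ b means a ∨ b ≈ b.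
  finAdd-mono : (h : FinAdd L) → ∀ {a b} → a ≤ b → fun h a ≤ fun h b
  finAdd-mono h {a} {b} a≤b = begin
      fun h a             ≤⟨ x≤x∨y (fun h a) (fun h b) ⟩
      fun h a ∨ fun h b   ≈⟨ Eq.sym (IsFinAdd.pres-∨ (isFinAdd h) a b) ⟩
      fun h (a ∨ b)       ≈⟨ IsFinAdd.cong (isFinAdd h) (antisym (∨-least a≤b refl) (y≤x∨y a b)) ⟩
      fun h b             ∎
    where open import Relation.Binary.Reasoning.PartialOrder poset

  _⊕_ : FinAdd L → FinAdd L → FinAdd L
  f ⊕ g = record
    { fun      = _∨ₚ_ L (fun f) (fun g)
    ; isFinAdd = record
      { cong   = λ x≈y → ∨-cong (F.cong f x≈y) (F.cong g x≈y)
      ; pres-⊥ = Eq.trans (∨-cong (F.pres-⊥ f) (F.pres-⊥ g)) (≤⊥⇒≈⊥ (∨-least refl refl))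
      ; pres-∨ = λ x y → Eq.trans (∨-cong (F.pres-∨ f x y) (F.pres-∨ g x y))
                                  (interchange (fun f x) (fun f y) (fun g x) (fun g y))
      }
    }
    where module F (h : FinAdd L) = IsFinAdd (isFinAdd h)

  Seq : Set (c ⊔ ℓ₁)
  Seq = ℕ → FinAdd L

  ⟦_⟧ : Seq → ℕ → Carrier → Carrier
  ⟦ hs ⟧ n = fun (hs n)

  tail : ∀ {a} {A : Set a} → (ℕ → A) → ℕ → A
  tail hs n = hs (suc n)

  _⊕ₛ_ : Seq → Seq → Seq
  (f ⊕ₛ g) n = f n ⊕ g n

  compose-suc : (hs : ℕ → Carrier → Carrier) (n : ℕ) (x : Carrier) →
                compose L hs (suc n) x ≡ compose L (tail hs) n (hs 0 x)
  compose-suc hs zero    x = P.refl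
  compose-suc hs (suc n) x = P.cong (hs (suc (suc n))) (compose-suc hs n x)

  compose-mono : (hs : Seq) (n : ℕ) → ∀ {a b} → a ≤ b →
                 compose L ⟦ hs ⟧ n a ≤ compose L ⟦ hs ⟧ n b
  compose-mono hs zero    a≤b = finAdd-mono (hs zero) a≤b
  compose-mono hs (suc n) a≤b = finAdd-mono (hs (suc n)) (compose-mono hs n a≤b)

  compose-subadditive : (hs : Seq) (n : ℕ) (a b : Carrier) →
    compose L ⟦ hs ⟧ n (a ∨ b) ≤ compose L ⟦ hs ⟧ n a ∨ compose L ⟦ hs ⟧ n b
  compose-subadditive hs zero    a b = reflexive (IsFinAdd.pres-∨ (isFinAdd (hs zero)) a b)
  compose-subadditive hs (suc n) a b =
    trans (finAdd-mono (hs (suc n)) (compose-subadditive hs n a b))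
          (reflexive (IsFinAdd.pres-∨ (isFinAdd (hs (suc n))) _ _))

  dies-later : (hs : Seq) {m n : ℕ} (x : Carrier) → m ≤′ n →
               compose L ⟦ hs ⟧ m x ≈ ⊥ → compose L ⟦ hs ⟧ n x ≈ ⊥
  dies-later hs x ≤′-refl           dead = dead
  dies-later hs x (≤′-step {n} m≤n) dead = ≤⊥⇒≈⊥ (begin
      fun (hs (suc n)) (compose L ⟦ hs ⟧ n x) ≤⟨ finAdd-mono (hs (suc n)) (reflexive (dies-later hs x m≤n dead)) ⟩
      fun (hs (suc n)) ⊥                      ≈⟨ IsFinAdd.pres-⊥ (isFinAdd (hs (suc n))) ⟩
      ⊥                                       ∎)
    where open import Relation.Binary.Reasoning.PartialOrder poset

  dies-join : (hs : Seq) {a b : Carrier} →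
              ∃ (λ m → compose L ⟦ hs ⟧ m a ≈ ⊥) → ∃ (λ m → compose L ⟦ hs ⟧ m b ≈ ⊥) →
              ∃ (λ m → compose L ⟦ hs ⟧ m (a ∨ b) ≈ ⊥)
  dies-join hs {a} {b} (m₁ , a-dead) (m₂ , b-dead) = m , ≤⊥⇒≈⊥
    (trans (compose-subadditive hs m a b)
           (∨-least (reflexive (dies-later hs a (≤⇒≤′ (m≤m⊔n m₁ m₂)) a-dead))
                    (reflexive (dies-later hs b (≤⇒≤′ (m≤n⊔m m₁ m₂)) b-dead))))
    where m = m₁ ⊔ℕ m₂

  ∏-nonzero : (hs : Seq) {x : Carrier} → ∏ L ⟦ hs ⟧ x → ¬ x ≈ ⊥
  ∏-nonzero hs alive x≈⊥ =
    alive (0 , Eq.trans (IsFinAdd.cong (isFinAdd (hs 0)) x≈⊥) (IsFinAdd.pres-⊥ (isFinAdd (hs 0))))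

  compose-dominated : (hs : ℕ → Carrier → Carrier) (ks : Seq) →
                      (∀ n y → hs n y ≤ ⟦ ks ⟧ n y) →
                      ∀ n x → compose L hs n x ≤ compose L ⟦ ks ⟧ n x
  compose-dominated hs ks hs≤ks zero    x = hs≤ks zero x
  compose-dominated hs ks hs≤ks (suc n) x =
    trans (hs≤ks (suc n) _) (finAdd-mono (ks (suc n)) (compose-dominated hs ks hs≤ks n x))

  ∏-antitone : (hs : ℕ → Carrier → Carrier) (ks : Seq) →
               (∀ n y → hs n y ≤ ⟦ ks ⟧ n y) → ∀ x → ∏ L hs x → ∏ L ⟦ ks ⟧ x
  ∏-antitone hs ks hs≤ks x alive (n , dead) =
    alive (n , ≤⊥⇒≈⊥ (trans (compose-dominated hs ks hs≤ks n x) (reflexive dead)))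

  choose-below : (ch : ℕ → Bool) (f g : Seq) → ∀ n y → choose L ch f g n y ≤ ⟦ f ⊕ₛ g ⟧ n y
  choose-below ch f g n y with ch n
  ... | true  = x≤x∨y _ _
  ... | false = y≤x∨y _ _

  survives-at-g : (f g : Seq) {x : Carrier} → ∏ L ⟦ f ⊕ₛ g ⟧ x →
                  ¬ ∏ L ⟦ tail (f ⊕ₛ g) ⟧ (fun (f 0) x) → ∏ L ⟦ tail (f ⊕ₛ g) ⟧ (fun (g 0) x)
  survives-at-g f g {x} alive f-dies g-dead = f-dies λ f-dead →
    let (m , joint-dead) = dies-join (tail (f ⊕ₛ g)) f-dead g-dead
    in  alive (suc m , P.subst (_≈ ⊥) (P.sym (compose-suc ⟦ f ⊕ₛ g ⟧ m x)) joint-dead)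

  chosen-survives : (f g : Seq) {x : Carrier} → ∏ L ⟦ f ⊕ₛ g ⟧ x →
                    (d : Dec (∏ L ⟦ tail (f ⊕ₛ g) ⟧ (fun (f 0) x))) →
                    ∏ L ⟦ tail (f ⊕ₛ g) ⟧ ((if isYes d then fun (f 0) else fun (g 0)) x)
  chosen-survives f g alive (yes f-alive) = f-alive
  chosen-survives f g alive (no  f-dies)  = survives-at-g f g alive f-dies

  module Greedy (em : ExcludedMiddle (c ⊔ ℓ₁ ⊔ ℓ₂)) where

    decide : (f g : Seq) (x : Carrier) → Dec (∏ L ⟦ tail (f ⊕ₛ g) ⟧ (fun (f 0) x))
    decide f g x = map′ lower lift (em {Lift (c ⊔ ℓ₂) _})

    greedy : Seq → Seq → Carrier → ℕ → Bool
    greedy f g x zero    = isYes (decide f g x)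
    greedy f g x (suc n) =
      greedy (tail f) (tail g) ((if isYes (decide f g x) then fun (f 0) else fun (g 0)) x) n

    greedy-survives : ∀ n (f g : Seq) x → ∏ L ⟦ f ⊕ₛ g ⟧ x →
                      ¬ compose L (choose L (greedy f g x) f g) n x ≈ ⊥
    greedy-survives zero f g x alive =
      ∏-nonzero (tail (f ⊕ₛ g)) (chosen-survives f g alive (decide f g x))
    greedy-survives (suc n) f g x alive dead =
      greedy-survives n (tail f) (tail g) _ (chosen-survives f g alive (decide f g x))
        (P.subst (_≈ ⊥) (compose-suc (choose L (greedy f g x) f g) n x) dead)

mainTheorem12 : ∀ {c ℓ₁ ℓ₂} → ExcludedMiddle (c ⊔ ℓ₁ ⊔ ℓ₂) →
    (L : CompleteLattice c ℓ₁ ℓ₂) → (f g : ℕ → FinAdd L) →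
    _≐_ L (∏ L (λ n → _∨ₚ_ L (fun (f n)) (fun (g n))))
    (⋁𝟐 L (λ ch → ∏ L (choose L ch f g)))
mainTheorem12 em L f g x = forward , backward
  where
    open FinAddSequences L
    open Greedy em

    forward : ∏ L ⟦ f ⊕ₛ g ⟧ x → ⋁𝟐 L (λ ch → ∏ L (choose L ch f g)) x
    forward alive = greedy f g x , λ (n , dead) → greedy-survives n f g x alive dead

    backward : ⋁𝟐 L (λ ch → ∏ L (choose L ch f g)) x → ∏ L ⟦ f ⊕ₛ g ⟧ x
    backward (ch , alive) = ∏-antitone (choose L ch f g) (f ⊕ₛ g) (choose-below ch f g) x alive
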